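{- For any constant specification $\mathcal{CS}$ and any formulae $A$ and $B$: (1) $\vdash_{\mathcal{CS}} t{:}_{\mathsf{E}}A\to A$ for all $t\in\mathrm{Tm}_{\mathsf{E}}$; (2) for any $t,s\in\mathrm{Tm}_{\mathsf{E}}$ there is a term $u\in\mathrm{Tm}_{\mathsf{E}}$ such that $\vdash_{\mathcal{CS}} t{:}_{\mathsf{E}}(A\to B)\to(s{:}_{\mathsf{E}}A\to u{:}_{\mathsf{E}}B)$; (3) for any $t,s\in\mathrm{Tm}_{\mathsf{E}}$ there is a term $u\in\mathrm{Tm}_{\mathsf{E}}$ such that $\vdash_{\mathcal{CS}} t{:}_{\mathsf{E}}A\to u{:}_{\mathsf{E}}A$ and $\vdash_{\mathcal{CS}} s{:}_{\mathsf{E}}A\to u{:}_{\mathsf{E}}A$; (4) for any $t\in\mathrm{Tm}_{\mathsf{C}}$ and any $i\in\{1,\dots,h\}$ there is a term $u\in\mathrm{Tm}_i$ such that $\vdash_{\mathcal{CS}} t{:}_{\mathsf{C}}A\to u{:}_iA$; (5) $\vdash_{\mathcal{CS}} t{:}_{\mathsf{C}}A\to A$ for all $t\in\mathrm{Tm}_{\mathsf{C}}$.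
   Context: Fix a number $h\ge 1$ of agents. Throughout, $i$ ranges over $\{1,\dots,h\}$, $*$ over $\{1,\dots,h,\mathsf{C}\}$, and $\circledast$ over $\{1,\dots,h,\mathsf{E},\mathsf{C}\}$. For each $\circledast$ let $\mathrm{Cons}_\circledast$ (proof constants) and $\mathrm{Var}_\circledast$ (proof variables) be countably infinite sets, all pairwise disjoint. Evidence terms $\mathrm{Tm}_1,\dots,\mathrm{Tm}_h,\mathrm{Tm}_{\mathsf{E}},\mathrm{Tm}_{\mathsf{C}}$ are defined by simultaneous induction: $\mathrm{Cons}_\circledast\cup\mathrm{Var}_\circledast\subseteq\mathrm{Tm}_\circledast$; if $t\in\mathrm{Tm}_i$ then $!_i t\in\mathrm{Tm}_i$; if $t,s\in\mathrm{Tm}_*$ then $t+_*s,\ t\cdot_* s\in\mathrm{Tm}_*$; if $t_1\in\mathrm{Tm}_1,\dots,t_h\in\mathrm{Tm}_h$ then $\langle t_1,\dots,t_h\rangle\in\mathrm{Tm}_{\mathsf{E}}$; if $t\in\mathrm{Tm}_{\mathsf{E}}$ then $\pi_i t\in\mathrm{Tm}_i$; if $t\in\mathrm{Tm}_{\mathsf{C}}$ then $\mathsf{hd}(t),\mathsf{tl}(t)\in\mathrm{Tm}_{\mathsf{E}}$; if $t\in\mathrm{Tm}_{\mathsf{C}}$ and $s\in\mathrm{Tm}_{\mathsf{E}}$ then $\mathsf{ind}(t,s)\in\mathrm{Tm}_{\mathsf{C}}$. Formulae are built from a countable set $\mathrm{Prop}$ of propositional variables using $\neg,\wedge,\vee,\to$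 and the rule: if $A$ is a formula and $t\in\mathrm{Tm}_\circledast$ then $t{:}_\circledast A$ is a formula (indices on $!,+,\cdot$ omitted when clear). Axioms of $\mathsf{LP}^{\mathsf{C}}_h$ (all instances): (1) propositional tautologies; (2) $t{:}_*(A\to B)\to(s{:}_*A\to (t\cdot s){:}_*B)$; (3) $t{:}_*A\to(t+s){:}_*A$ and $s{:}_*A\to(t+s){:}_*A$; (4) $t{:}_iA\to A$; (5) $t{:}_iA\to (!t){:}_i\, t{:}_iA$; (6) $t_1{:}_1A\wedge\dots\wedge t_h{:}_hA\to\langle t_1,\dots,t_h\rangle{:}_{\mathsf{E}}A$; (7) $t{:}_{\mathsf{E}}A\to (\pi_it){:}_iA$; (8) $t{:}_{\mathsf{C}}A\to\mathsf{hd}(t){:}_{\mathsf{E}}A$ and $t{:}_{\mathsf{C}}A\to\mathsf{tl}(t){:}_{\mathsf{E}}\,t{:}_{\mathsf{C}}A$; (9) $A\wedge t{:}_{\mathsf{C}}(A\to s{:}_{\mathsf{E}}A)\to\mathsf{ind}(t,s){:}_{\mathsf{C}}A$. A constant specification $\mathcal{CS}$ is any set of formulae $c{:}_\circledast A$ with $c\in\mathrm{Cons}_\circledast$ and $A$ an axiom. $\mathsf{LP}^{\mathsf{C}}_h(\mathcal{CS})$ is the Hilbert system with these axioms, modus ponens, and axiom necessitation (derive $c{:}_\circledast A$ whenever $c{:}_\circledast A\in\mathcal{CS}$); $\vdash_{\mathcal{CS}}A$ means $A$ is derivable in it. -}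

module Defs where

open import Data.Nat using (ℕ)
open import Data.Fin using (Fin)
import Data.Fin as Fin
open import Data.Vec using (Vec)
open import Data.Product using (Σ; _×_; _,_)
open import Relation.Binary.PropositionalEquality using (_≡_)

data Sort (h : ℕ) : Set where
  ag : Fin h → Sort h
  E  : Sort h
  C  : Sort h

data Star {h : ℕ} : Sort h → Set where
  star-ag : (i : Fin h) → Star (ag i)
  star-C  : Star C

-- Proof constants and proof variables of sort ⊛ are
-- indexed by ℕ (countably infinite sets, disjoint across sorts and kinds
-- since they are separate constructors indexed by the sort).
data Tm (h : ℕ) : Sort h → Set where
  cons : ∀ {σ} → ℕ → Tm h σ
  var  : ∀ {σ} → ℕ → Tm h σ
  bang : ∀ {i} → Tm h (ag i) → Tm h (ag i)
  plus : ∀ {σ} → Star σ → Tm h σ → Tm h σ → Tm h σ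
  app  : ∀ {σ} → Star σ → Tm h σ → Tm h σ → Tm h σ
  tup  : ((i : Fin h) → Tm h (ag i)) → Tm h E
  proj : (i : Fin h) → Tm h E → Tm h (ag i)
  hd   : Tm h C → Tm h E
  tl   : Tm h C → Tm h E
  ind  : Tm h C → Tm h E → Tm h C

data Fm (h : ℕ) : Set where
  pv    : ℕ → Fm h
  ¬'_   : Fm h → Fm h
  _∧'_  : Fm h → Fm h → Fm h
  _∨'_  : Fm h → Fm h → Fm h
  _⇒_   : Fm h → Fm h → Fm h
  jst : (σ : Sort h) → Tm h σ → Fm h → Fm h

infixr 5 _⇒_
infixr 7 _∧'_
infixr 6 _∨'_

_∷_∶_ : ∀ {h} (σ : Sort h) → Tm h σ → Fm h → Fm h
σ ∷ t ∶ A = jst σ t A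

-- Classical two-valued semantics for propositional tautologies:
-- a formula is a tautology if it is true under every valuation treating
-- propositional variables and justification formulae t:_σ B as atoms.
data Bool' : Set where tt ff : Bool'

not' : Bool' → Bool'
not' tt = ff
not' ff = tt

and' or' imp' : Bool' → Bool' → Bool'
and' tt b = b
and' ff _ = ff
or' tt _ = tt
or' ff b = b
imp' tt b = b
imp' ff _ = tt

record Valuation (h : ℕ) : Set where
  field
    vp : ℕ → Bool'
    vj : (σ : Sort h) → Tm h σ → Fm h → Bool'

eval : ∀ {h} → Valuation h → Fm h → Bool'
eval v (pv p) = Valuation.vp v p
eval v (¬' A) = not' (eval v A)
eval v (A ∧' B) = and' (eval v A) (eval v B)
eval v (A ∨' B) = or' (eval v A) (eval v B)
eval v (A ⇒ B) = imp' (eval v A) (eval v B)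
eval v (jst σ t A) = Valuation.vj v σ t A

Tautology : ∀ {h} → Fm h → Set
Tautology {h} A = (v : Valuation h) → eval v A ≡ tt

-- The case of 0 conjuncts only arises for h = 0, which is excluded by the
-- standing assumption h ≥ 1; we set it to a fixed tautology there.
bigAnd : ∀ {h} (k : ℕ) → (Fin k → Fm h) → Fm h
bigAnd ℕ.zero f = pv 0 ⇒ pv 0
bigAnd (ℕ.suc ℕ.zero) f = f Fin.zero
bigAnd (ℕ.suc (ℕ.suc k)) f = f Fin.zero ∧' bigAnd (ℕ.suc k) (λ j → f (Fin.suc j))

data Axiom {h : ℕ} : Fm h → Set where
  ax-taut : ∀ {A} → Tautology A → Axiom A
  ax-app  : ∀ {σ} (st : Star σ) (t s : Tm h σ) (A B : Fm h) →
            Axiom ((σ ∷ t ∶ (A ⇒ B)) ⇒ ((σ ∷ s ∶ A) ⇒ (σ ∷ app st t s ∶ B)))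
  ax-sumˡ : ∀ {σ} (st : Star σ) (t s : Tm h σ) (A : Fm h) →
            Axiom ((σ ∷ t ∶ A) ⇒ (σ ∷ plus st t s ∶ A))
  ax-sumʳ : ∀ {σ} (st : Star σ) (t s : Tm h σ) (A : Fm h) →
            Axiom ((σ ∷ s ∶ A) ⇒ (σ ∷ plus st t s ∶ A))
  ax-refl : (i : Fin h) (t : Tm h (ag i)) (A : Fm h) →
            Axiom ((ag i ∷ t ∶ A) ⇒ A)
  ax-bang : (i : Fin h) (t : Tm h (ag i)) (A : Fm h) →
            Axiom ((ag i ∷ t ∶ A) ⇒ (ag i ∷ bang t ∶ (ag i ∷ t ∶ A)))
  ax-tup  : (ts : (i : Fin h) → Tm h (ag i)) (A : Fm h) →
            Axiom (bigAnd h (λ i → ag i ∷ ts i ∶ A) ⇒ (E ∷ tup ts ∶ A))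
  ax-proj : (i : Fin h) (t : Tm h E) (A : Fm h) →
            Axiom ((E ∷ t ∶ A) ⇒ (ag i ∷ proj i t ∶ A))
  ax-hd   : (t : Tm h C) (A : Fm h) →
            Axiom ((C ∷ t ∶ A) ⇒ (E ∷ hd t ∶ A))
  ax-tl   : (t : Tm h C) (A : Fm h) →
            Axiom ((C ∷ t ∶ A) ⇒ (E ∷ tl t ∶ (C ∷ t ∶ A)))
  ax-ind  : (t : Tm h C) (s : Tm h E) (A : Fm h) →
            Axiom ((A ∧' (C ∷ t ∶ (A ⇒ (E ∷ s ∶ A)))) ⇒ (C ∷ ind t s ∶ A))

record ConstSpec (h : ℕ) : Set₁ where
  field
    mem   : (σ : Sort h) → ℕ → Fm h → Set
    axiom : ∀ {σ c A} → mem σ c A → Axiom A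

data _⊢_ {h : ℕ} (CS : ConstSpec h) : Fm h → Set where
  d-ax  : ∀ {A} → Axiom A → CS ⊢ A
  d-mp  : ∀ {A B} → CS ⊢ (A ⇒ B) → CS ⊢ A → CS ⊢ B
  d-nec : ∀ {σ c A} → ConstSpec.mem CS σ c A → CS ⊢ (σ ∷ cons c ∶ A)

infix 2 _⊢_

module Submission where

open import Defs
open import Data.Nat using (ℕ; _≤_)
open import Data.Fin using (Fin; fromℕ<)
import Data.Fin as Fin
open import Data.Product using (Σ; _×_; _,_)
open import Relation.Binary.PropositionalEquality using (refl)

-- E-knowledge is the conjunction of the agents' knowledge, read off componentwise
-- through the projections π i; C-knowledge yields E-knowledge through hd. So every
-- claim reduces to an agent axiom applied in each component, reassembled by ⟨_⟩,
-- and reflexivity of E and C is inherited from a single agent's reflexivity (hence h ≥ 1).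

module Tautologies {h : ℕ} where

  taut-K : (X Y : Fm h) → Tautology (X ⇒ (Y ⇒ X))
  taut-K X Y v with eval v X | eval v Y
  ... | ff | _  = refl
  ... | tt | tt = refl
  ... | tt | ff = refl

  taut-S : (X Y Z : Fm h) → Tautology ((X ⇒ (Y ⇒ Z)) ⇒ ((X ⇒ Y) ⇒ (X ⇒ Z)))
  taut-S X Y Z v with eval v X | eval v Y | eval v Z
  ... | ff | _  | _  = refl
  ... | tt | ff | _  = refl
  ... | tt | tt | tt = refl
  ... | tt | tt | ff = refl

  taut-id : (X : Fm h) → Tautology (X ⇒ X)
  taut-id X v with eval v X
  ... | tt = refl
  ... | ff = refl

  taut-pair : (X Y : Fm h) → Tautology (X ⇒ (Y ⇒ (X ∧' Y)))
  taut-pair X Y v with eval v X | eval v Y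
  ... | ff | _  = refl
  ... | tt | tt = refl
  ... | tt | ff = refl

  taut-proj₁ : (X Y : Fm h) → Tautology ((X ∧' Y) ⇒ X)
  taut-proj₁ X Y v with eval v X | eval v Y
  ... | ff | _  = refl
  ... | tt | tt = refl
  ... | tt | ff = refl

  taut-proj₂ : (X Y : Fm h) → Tautology ((X ∧' Y) ⇒ Y)
  taut-proj₂ X Y v with eval v X | eval v Y
  ... | ff | _  = refl
  ... | tt | tt = refl
  ... | tt | ff = refl

  taut-curry : (X Y Z : Fm h) → Tautology (((X ∧' Y) ⇒ Z) ⇒ (X ⇒ (Y ⇒ Z)))
  taut-curry X Y Z v with eval v X | eval v Y | eval v Z
  ... | ff | _  | _  = refl
  ... | tt | ff | _  = refl
  ... | tt | tt | tt = refl
  ... | tt | tt | ff = refl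

open Tautologies

module _ {h : ℕ} where

  infixl 7 _·ᴱ_ _+ᴱ_
  _·ᴱ_ _+ᴱ_ : Tm h E → Tm h E → Tm h E
  t ·ᴱ s = tup λ i → app (star-ag i) (proj i t) (proj i s)
  t +ᴱ s = tup λ i → plus (star-ag i) (proj i t) (proj i s)

module Derivable {h : ℕ} (CS : ConstSpec h) where

  taut : ∀ {X} → Tautology X → CS ⊢ X
  taut p = d-ax (ax-taut p)

  infixl 4 _·_
  _·_ : ∀ {X Y} → CS ⊢ X ⇒ Y → CS ⊢ X → CS ⊢ Y
  _·_ = d-mp

  weaken : ∀ {H X} → CS ⊢ X → CS ⊢ H ⇒ X
  weaken {H} {X} p = taut (taut-K X H) · p

  mp-under : ∀ {H X Y} → CS ⊢ H ⇒ (X ⇒ Y) → CS ⊢ H ⇒ X → CS ⊢ H ⇒ Y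
  mp-under {H} {X} {Y} p q = taut (taut-S H X Y) · p · q

  ⇒-trans : ∀ {X Y Z} → CS ⊢ X ⇒ Y → CS ⊢ Y ⇒ Z → CS ⊢ X ⇒ Z
  ⇒-trans p q = mp-under (weaken q) p

  ∧-intro : ∀ {H X Y} → CS ⊢ H ⇒ X → CS ⊢ H ⇒ Y → CS ⊢ H ⇒ (X ∧' Y)
  ∧-intro {X = X} {Y} p q = mp-under (mp-under (weaken (taut (taut-pair X Y))) p) q

  ∧-proj₁ : ∀ {X Y} → CS ⊢ (X ∧' Y) ⇒ X
  ∧-proj₁ {X} {Y} = taut (taut-proj₁ X Y)

  ∧-proj₂ : ∀ {X Y} → CS ⊢ (X ∧' Y) ⇒ Y
  ∧-proj₂ {X} {Y} = taut (taut-proj₂ X Y)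

  curry : ∀ {X Y Z} → CS ⊢ (X ∧' Y) ⇒ Z → CS ⊢ X ⇒ (Y ⇒ Z)
  curry {X} {Y} {Z} p = taut (taut-curry X Y Z) · p

  bigAnd-intro : ∀ {H} (k : ℕ) (f : Fin k → Fm h) →
                 ((j : Fin k) → CS ⊢ H ⇒ f j) → CS ⊢ H ⇒ bigAnd k f
  bigAnd-intro ℕ.zero            f p = weaken (taut (taut-id (pv 0)))
  bigAnd-intro (ℕ.suc ℕ.zero)    f p = p Fin.zero
  bigAnd-intro (ℕ.suc (ℕ.suc k)) f p =
    ∧-intro (p Fin.zero) (bigAnd-intro (ℕ.suc k) (λ j → f (Fin.suc j)) (λ j → p (Fin.suc j)))

  app-under : ∀ {H σ A B} (st : Star σ) {t s : Tm h σ} →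
              CS ⊢ H ⇒ (σ ∷ t ∶ (A ⇒ B)) → CS ⊢ H ⇒ (σ ∷ s ∶ A) →
              CS ⊢ H ⇒ (σ ∷ app st t s ∶ B)
  app-under st {t} {s} p q = mp-under (⇒-trans p (d-ax (ax-app st t s _ _))) q

  proj-under : ∀ {H A} (i : Fin h) {t : Tm h E} →
               CS ⊢ H ⇒ (E ∷ t ∶ A) → CS ⊢ H ⇒ (ag i ∷ proj i t ∶ A)
  proj-under i {t} p = ⇒-trans p (d-ax (ax-proj i t _))

  tup-intro : ∀ {H A} (ts : (i : Fin h) → Tm h (ag i)) →
              ((i : Fin h) → CS ⊢ H ⇒ (ag i ∷ ts i ∶ A)) → CS ⊢ H ⇒ (E ∷ tup ts ∶ A)
  tup-intro ts p = ⇒-trans (bigAnd-intro h _ p) (d-ax (ax-tup ts _))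

  E-refl : Fin h → ∀ {A} (t : Tm h E) → CS ⊢ (E ∷ t ∶ A) ⇒ A
  E-refl i t = ⇒-trans (d-ax (ax-proj i t _)) (d-ax (ax-refl i (proj i t) _))

  E-app : ∀ {A B} (t s : Tm h E) →
          CS ⊢ (E ∷ t ∶ (A ⇒ B)) ⇒ ((E ∷ s ∶ A) ⇒ (E ∷ t ·ᴱ s ∶ B))
  E-app t s = curry (tup-intro _ λ i →
    app-under (star-ag i) (proj-under i ∧-proj₁) (proj-under i ∧-proj₂))

  E-sumˡ : ∀ {A} (t s : Tm h E) →
           CS ⊢ (E ∷ t ∶ A) ⇒ (E ∷ t +ᴱ s ∶ A)
  E-sumˡ t s = tup-intro _ λ i →
    ⇒-trans (d-ax (ax-proj i t _)) (d-ax (ax-sumˡ (star-ag i) (proj i t) (proj i s) _))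

  E-sumʳ : ∀ {A} (t s : Tm h E) →
           CS ⊢ (E ∷ s ∶ A) ⇒ (E ∷ t +ᴱ s ∶ A)
  E-sumʳ t s = tup-intro _ λ i →
    ⇒-trans (d-ax (ax-proj i s _)) (d-ax (ax-sumʳ (star-ag i) (proj i t) (proj i s) _))

  C-to-agent : ∀ {A} (t : Tm h C) (i : Fin h) → CS ⊢ (C ∷ t ∶ A) ⇒ (ag i ∷ proj i (hd t) ∶ A)
  C-to-agent t i = proj-under i (d-ax (ax-hd t _))

  C-refl : Fin h → ∀ {A} (t : Tm h C) → CS ⊢ (C ∷ t ∶ A) ⇒ A
  C-refl i t = ⇒-trans (d-ax (ax-hd t _)) (E-refl i (hd t))

lemma1 : (h : ℕ) → 1 ≤ h → (CS : ConstSpec h) → (A B : Fm h) →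
    ((t : Tm h E) → CS ⊢ ((E ∷ t ∶ A) ⇒ A))
    × ((t s : Tm h E) → Σ (Tm h E) (λ u →
         CS ⊢ ((E ∷ t ∶ (A ⇒ B)) ⇒ ((E ∷ s ∶ A) ⇒ (E ∷ u ∶ B)))))
    × ((t s : Tm h E) → Σ (Tm h E) (λ u →
         (CS ⊢ ((E ∷ t ∶ A) ⇒ (E ∷ u ∶ A))) × (CS ⊢ ((E ∷ s ∶ A) ⇒ (E ∷ u ∶ A)))))
    × ((t : Tm h C) → (i : Fin h) → Σ (Tm h (ag i)) (λ u →
         CS ⊢ ((C ∷ t ∶ A) ⇒ (ag i ∷ u ∶ A))))
    × ((t : Tm h C) → CS ⊢ ((C ∷ t ∶ A) ⇒ A))
lemma1 h 1≤h CS A B =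
    E-refl agent
  , (λ t s → _ , E-app t s)
  , (λ t s → _ , E-sumˡ t s , E-sumʳ t s)
  , (λ t i → _ , C-to-agent t i)
  , C-refl agent
  where
  open Derivable CS
  agent : Fin h
  agent = fromℕ< 1≤h
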